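{- Let $V=\{1,\dots,n\}$, let $f:2^V\to\mathbb{R}_{\ge0}$ be a nonnegative submodular function with $f(\emptyset)=0$, let $X^*\in\operatorname{argmax}_{X\subseteq V}f(X)$, and let $\tau=(u_1,\dots,u_n)$ be any ordering of $V$. Let $\sigma^\tau$ be the permutation of $V$ induced by the deterministic bi-directional greedy algorithm run with ordering $\tau$ (the elements of its output set $S^\tau$ occupy the first $|S^\tau|$ positions, in the order they were added, followed by the remaining elements). Let $X^1\in\operatorname{argmax}_{X\subseteq V}h^{\sigma^\tau}_\emptyset(X)$ be the set obtained after the first iteration of unconstrained MMax from $X^0=\emptyset$ with this subgradient. Then $f(X^1)\ge\frac13 f(X^*)$.
   Context: Deterministic bi-directional greedy with ordering $\tau$: set $X_0=\emptyset$, $Y_0=V$; for $i=1,\dots,n$ let $a_i=f(X_{i-1}\cup\{u_i\})-f(X_{i-1})$ and $b_i=f(Y_{i-1}\setminus\{u_i\})-f(Y_{i-1})$; if $a_i\ge b_i$ set $X_i=X_{i-1}\cup\{u_i\}$, $Y_i=Y_{i-1}$, else set $X_i=X_{i-1}$, $Y_i=Y_{i-1}\setminus\{u_i\}$; output $S^\tau=X_n=Y_n$. For a permutation $\sigma$ of $V$ let $S^\sigma_i=\{\sigma(1),\dots,\sigma(i)\}$, $S^\sigma_0=\emptyset$, and $h^\sigma_\emptyset(\sigma(i))=f(S^\sigma_i)-f(S^\sigma_{i-1})$; $h(X)=\sum_{j\in X}h(j)$.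
   Formalization: The set function f takes values in the nonnegative rationals rather than in $\mathbb{R}_{\ge0}$. -}

module Defs where

open import Data.Bool using (Bool; true; false; if_then_else_)
open import Data.Nat as ℕ using (ℕ; zero; suc; _<ᵇ_)
open import Data.Fin using (Fin; toℕ)
open import Data.Fin.Subset using (Subset; _∪_; _∩_; ⁅_⁆; _─_; ⊥; ⊤; _⊆_)
open import Data.Fin.Permutation using (Permutation′; _⟨$⟩ʳ_; _⟨$⟩ˡ_)
open import Data.Vec using (tabulate; lookup)
open import Data.List using (List; []; _∷_; _∷ʳ_; map; allFin; foldr)
open import Relation.Binary.PropositionalEquality using (_≡_)
open import Data.Product using (_×_; _,_; proj₁; proj₂)
open import Data.Rational using (ℚ; 0ℚ; _+_; _-_; _≤_; _≤ᵇ_)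

-- Set functions on V = Fin n (V = {1,…,n} re-indexed from 0), values in ℚ.
SetFn : ℕ → Set
SetFn n = Subset n → ℚ

Nonneg : ∀ {n} → SetFn n → Set
Nonneg f = ∀ A → 0ℚ ≤ f A

Normalized : ∀ {n} → SetFn n → Set
Normalized f = f ⊥ ≡ 0ℚ

Submodular : ∀ {n} → SetFn n → Set
Submodular f = ∀ A B → f (A ∪ B) + f (A ∩ B) ≤ f A + f B

IsMaximizer : ∀ {n} → (Subset n → ℚ) → Subset n → Set
IsMaximizer g X = ∀ Y → g Y ≤ g X

-- State of the bi-directional greedy: (X , Y , list of elements added to X, in order)
GState : ℕ → Set
GState n = Subset n × Subset n × List (Fin n)

greedyStep : ∀ {n} → SetFn n → GState n → Fin n → GState n
greedyStep f (X , Y , L) u =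
  let a = f (X ∪ ⁅ u ⁆) - f X
      b = f (Y ─ ⁅ u ⁆) - f Y
  in if b ≤ᵇ a then (X ∪ ⁅ u ⁆ , Y , L ∷ʳ u) else (X , Y ─ ⁅ u ⁆ , L)

greedyRun : ∀ {n} → SetFn n → GState n → List (Fin n) → GState n
greedyRun f s []       = s
greedyRun f s (u ∷ us) = greedyRun f (greedyStep f s u) us

-- ordering τ : u_{i+1} = τ(i), i = 0,…,n-1
greedy : ∀ {n} → SetFn n → Permutation′ n → GState n
greedy {n} f τ = greedyRun f (⊥ , ⊤ , []) (map (τ ⟨$⟩ʳ_) (allFin n))

-- output set S^τ (= X_n = Y_n)
greedyOut : ∀ {n} → SetFn n → Permutation′ n → Subset n
greedyOut f τ = proj₁ (greedy f τ)

greedyAdded : ∀ {n} → SetFn n → Permutation′ n → List (Fin n)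
greedyAdded f τ = proj₂ (proj₂ (greedy f τ))

-- S^σ_k = {σ(0),…,σ(k-1)}
prefix : ∀ {n} → Permutation′ n → ℕ → Subset n
prefix σ k = tabulate (λ x → toℕ (σ ⟨$⟩ˡ x) <ᵇ k)

-- h^σ_∅(σ(i)) = f(S^σ_{i+1}) - f(S^σ_i)
hElem : ∀ {n} → SetFn n → Permutation′ n → Fin n → ℚ
hElem f σ x = let i = toℕ (σ ⟨$⟩ˡ x) in f (prefix σ (suc i)) - f (prefix σ i)

hSet : ∀ {n} → SetFn n → Permutation′ n → Subset n → ℚ
hSet {n} f σ X =
  foldr _+_ 0ℚ (map (λ x → if lookup X x then hElem f σ x else 0ℚ) (allFin n))

{-# OPTIONS --safe #-}
module Submission where

-- Along the double greedy (with X ⊆ Y throughout) the potential f((Xstar ∪ X) ∩ Y) + f X + f Y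
-- never decreases: a + b ≥ 0 by submodularity, and in each of the four cases (u added or removed,
-- u ∈ Xstar or not) diminishing returns bound the change of the first term.  The potential starts
-- at f Xstar + f ∅ + f V ≥ f Xstar and ends at 3 f(S^τ).
-- On the other side, the modular function h = h^σ_∅ satisfies h(X) + f ∅ ≤ f X for every X
-- (adding the elements of X in the order of σ, each gain is at most the gain along the chain of
-- prefixes of σ), with equality on those prefixes.  The hypothesis on σ says that S^τ is the
-- prefix of σ of length |S^τ|, so f X¹ ≥ h(X¹) + f ∅ ≥ h(S^τ) + f ∅ = f(S^τ) ≥ f Xstar / 3.

open import Defs
open import Data.Bool using (Bool; true; false; T; _∨_; if_then_else_)
open import Data.Bool.Properties using (T-≡; ∨-identityʳ)
open import Data.Nat as ℕ using (ℕ; zero; suc; _<_; _<ᵇ_; _⊓_; z<s; s<s)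
open import Data.Nat.Properties
  using (module ≤-Reasoning; m⊓n≤n; <⇒≤; ≤-refl; <ᵇ⇒<; <⇒<ᵇ; n≮0; n≮n; n<1+n; m<n⇒m<1+n; m<1+n⇒m<n∨m≡n)
open import Data.Integer using (+_)
open import Data.Rational using (ℚ; 0ℚ; _+_; _-_; -_; _*_; _/_; _≤_; _≤ᵇ_)
import Data.Rational.Properties as ℚ
open import Data.Rational.Solver using (module +-*-Solver)
open +-*-Solver using (solve; _:+_; _:-_; _:*_; _:=_; con)
open import Data.Fin using (Fin; zero; suc; toℕ; fromℕ<)
open import Data.Fin.Properties using (_≟_; toℕ-injective; toℕ<n; toℕ-fromℕ<)
open import Data.Fin.Subset using (Subset; _∈_; _∉_; _⊆_; _∪_; _∩_; _─_; ⁅_⁆; ⊥; ⊤)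
open import Data.Fin.Subset.Properties
open import Data.Fin.Permutation using (Permutation′; _⟨$⟩ʳ_; _⟨$⟩ˡ_; inverseˡ; inverseʳ)
open import Data.Vec using (_∷_; here; there; lookup)
open import Data.Vec.Properties using (lookup∘tabulate; lookup⇒[]=; []=⇒lookup)
open import Data.List using (List; []; _∷_; _∷ʳ_; foldr; map; take; length; tabulate; allFin)
open import Data.List.Properties using (map-tabulate; length-take; length-map; length-tabulate)
open import Data.List.Membership.Propositional using () renaming (_∈_ to _∈ₗ_)
open import Data.List.Membership.Propositional.Properties using (∈-++⁺ˡ; ∈-++⁺ʳ; ∈-++⁻; ∈-map⁺; ∈-allFin)
open import Data.List.Relation.Unary.Any using (here; there)
import Data.List.Relation.Unary.All as All
import Data.List.Relation.Unary.AllPairs as AllPairs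
open import Data.List.Relation.Unary.Unique.Propositional using (Unique)
import Data.List.Relation.Unary.Unique.Propositional.Properties as Unique
open import Data.Product using (∃; _×_; _,_; proj₁; proj₂)
open import Data.Sum using (_⊎_; inj₁; inj₂; [_,_])
open import Function using (id; _∘_; Equivalence)
open import Relation.Nullary using (Dec; yes; no; contradiction)
open import Relation.Binary.PropositionalEquality
  using (_≡_; _≢_; refl; sym; trans; cong; cong₂; subst; subst₂; module ≡-Reasoning)

private variable
  n : ℕ
  p q r : Subset n
  x u : Fin n

x∈p⇒⁅x⁆⊆p : x ∈ p → ⁅ x ⁆ ⊆ p
x∈p⇒⁅x⁆⊆p {x = x} x∈p y∈⁅x⁆ = subst (_∈ _) (sym (x∈⁅y⁆⇒x≡y x y∈⁅x⁆)) x∈p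

p⊆q⇒p∪q≡q : p ⊆ q → p ∪ q ≡ q
p⊆q⇒p∪q≡q {p = p} {q = q} p⊆q = ⊆-antisym (λ x∈ → [ p⊆q , id ] (x∈p∪q⁻ p q x∈)) (q⊆p∪q p q)

p⊆q⇒p∩q≡p : p ⊆ q → p ∩ q ≡ p
p⊆q⇒p∩q≡p {p = p} {q = q} p⊆q = ⊆-antisym (p∩q⊆p p q) (λ x∈p → x∈p∩q⁺ (x∈p , p⊆q x∈p))

x∉p⇒⁅x⁆∩p≡⊥ : x ∉ p → ⁅ x ⁆ ∩ p ≡ ⊥
x∉p⇒⁅x⁆∩p≡⊥ {x = x} {p = p} x∉p = ⊆-antisym (λ y∈ → contradiction (x∈p y∈) x∉p) ⊥⊆
  where
  x∈p : ∀ {y} → y ∈ ⁅ x ⁆ ∩ p → x ∈ p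
  x∈p y∈ = let y∈⁅x⁆ , y∈p = x∈p∩q⁻ ⁅ x ⁆ p y∈ in subst (_∈ p) (x∈⁅y⁆⇒x≡y x y∈⁅x⁆) y∈p

x∈p─q⇒x∉q : ∀ (p q : Subset n) → x ∈ p ─ q → x ∉ q
x∈p─q⇒x∉q (_ ∷ p) (_ ∷ q) () here
x∈p─q⇒x∉q (_ ∷ p) (_ ∷ q) (there x∈p─q) (there x∈q) = x∈p─q⇒x∉q p q x∈p─q x∈q

x∉p-x : x ∉ p ─ ⁅ x ⁆
x∉p-x {x = x} {p = p} x∈ = x∈p─q⇒x∉q p ⁅ x ⁆ x∈ (x∈⁅x⁆ x)

p⊆q∧x∉p⇒p⊆q-x : p ⊆ q → x ∉ p → p ⊆ q ─ ⁅ x ⁆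
p⊆q∧x∉p⇒p⊆q-x p⊆q x∉p y∈p = x∈p∧x≢y⇒x∈p-y (p⊆q y∈p) (λ { refl → x∉p y∈p })

x∉p⇒p-x≡p : x ∉ p → p ─ ⁅ x ⁆ ≡ p
x∉p⇒p-x≡p {p = p} x∉p = ⊆-antisym (p─q⊆p p _) (p⊆q∧x∉p⇒p⊆q-x ⊆-refl x∉p)

x∈p⇒p-x∪⁅x⁆≡p : x ∈ p → (p ─ ⁅ x ⁆) ∪ ⁅ x ⁆ ≡ p
x∈p⇒p-x∪⁅x⁆≡p {x = x} {p = p} x∈p = ⊆-antisym
  (λ y∈ → [ p─q⊆p p ⁅ x ⁆ , x∈p⇒⁅x⁆⊆p x∈p ] (x∈p∪q⁻ _ _ y∈))
  (λ {y} y∈p → x∈p∪q⁺ (split (y ≟ x) y∈p))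
  where
  split : ∀ {y} → Dec (y ≡ x) → y ∈ p → y ∈ p ─ ⁅ x ⁆ ⊎ y ∈ ⁅ x ⁆
  split (yes refl) _   = inj₂ (x∈⁅x⁆ x)
  split (no y≢x)   y∈p = inj₁ (x∈p∧x≢y⇒x∈p-y y∈p y≢x)

p∩[q─r]≡p∩q─r : p ∩ (q ─ r) ≡ p ∩ q ─ r
p∩[q─r]≡p∩q─r {p = p} {q = q} {r = r} = ⊆-antisym
  (λ x∈ → let x∈p , x∈q─r = x∈p∩q⁻ p (q ─ r) x∈
          in x∈p∧x∉q⇒x∈p─q (x∈p∩q⁺ (x∈p , p─q⊆p q r x∈q─r)) (x∈p─q⇒x∉q q r x∈q─r))
  (λ x∈ → let x∈p , x∈q = x∈p∩q⁻ p q (p─q⊆p (p ∩ q) r x∈)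
          in x∈p∩q⁺ (x∈p , x∈p∧x∉q⇒x∈p─q x∈q (x∈p─q⇒x∉q (p ∩ q) r x∈)))

x∈p⇒p∪⁅x⁆≡p : x ∈ p → p ∪ ⁅ x ⁆ ≡ p
x∈p⇒p∪⁅x⁆≡p {x = x} {p = p} x∈p = trans (∪-comm p ⁅ x ⁆) (p⊆q⇒p∪q≡q (x∈p⇒⁅x⁆⊆p x∈p))

x∈q⇒[p∪⁅x⁆]∩q≡p∩q∪⁅x⁆ : x ∈ q → (p ∪ ⁅ x ⁆) ∩ q ≡ p ∩ q ∪ ⁅ x ⁆
x∈q⇒[p∪⁅x⁆]∩q≡p∩q∪⁅x⁆ {x = x} {q = q} {p = p} x∈q =
  trans (∩-distribʳ-∪ q p ⁅ x ⁆) (cong ((p ∩ q) ∪_) (p⊆q⇒p∩q≡p (x∈p⇒⁅x⁆⊆p x∈q)))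

x∉q⇒[p∪⁅x⁆]∩q≡p∩q : x ∉ q → (p ∪ ⁅ x ⁆) ∩ q ≡ p ∩ q
x∉q⇒[p∪⁅x⁆]∩q≡p∩q {x = x} {q = q} {p = p} x∉q = begin
  (p ∪ ⁅ x ⁆) ∩ q        ≡⟨ ∩-distribʳ-∪ q p ⁅ x ⁆ ⟩
  (p ∩ q) ∪ (⁅ x ⁆ ∩ q)  ≡⟨ cong ((p ∩ q) ∪_) (x∉p⇒⁅x⁆∩p≡⊥ x∉q) ⟩
  (p ∩ q) ∪ ⊥            ≡⟨ ∪-identityʳ (p ∩ q) ⟩
  p ∩ q                  ∎
  where open ≡-Reasoning

p⊆q⇒[p∪⁅x⁆]∪q≡q∪⁅x⁆ : p ⊆ q → (p ∪ ⁅ x ⁆) ∪ q ≡ q ∪ ⁅ x ⁆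
p⊆q⇒[p∪⁅x⁆]∪q≡q∪⁅x⁆ {p = p} {q = q} {x = x} p⊆q = begin
  (p ∪ ⁅ x ⁆) ∪ q  ≡⟨ ∪-assoc p ⁅ x ⁆ q ⟩
  p ∪ (⁅ x ⁆ ∪ q)  ≡⟨ cong (p ∪_) (∪-comm ⁅ x ⁆ q) ⟩
  p ∪ (q ∪ ⁅ x ⁆)  ≡⟨ ∪-assoc p q ⁅ x ⁆ ⟨
  (p ∪ q) ∪ ⁅ x ⁆  ≡⟨ cong (_∪ ⁅ x ⁆) (p⊆q⇒p∪q≡q p⊆q) ⟩
  q ∪ ⁅ x ⁆        ∎
  where open ≡-Reasoning

p≤q⇒0≤q-p : ∀ {p q : ℚ} → p ≤ q → 0ℚ ≤ q - p
p≤q⇒0≤q-p {p} {q} p≤q = subst (_≤ q - p) (ℚ.+-inverseʳ p) (ℚ.+-monoˡ-≤ (- p) p≤q)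

0≤q-p⇒p≤q : ∀ {p q : ℚ} → 0ℚ ≤ q - p → p ≤ q
0≤q-p⇒p≤q {p} {q} 0≤q-p =
  subst₂ _≤_ (ℚ.+-identityˡ p) (solve 2 (λ p q → (q :- p) :+ p := q) refl p q) (ℚ.+-monoˡ-≤ p 0≤q-p)

≤-by-sum : ∀ {p₁ q₁ p₂ q₂ p q : ℚ} → p₁ ≤ q₁ → p₂ ≤ q₂ →
           (q₁ - p₁) + (q₂ - p₂) ≡ q - p → p ≤ q
≤-by-sum p₁≤q₁ p₂≤q₂ eq =
  0≤q-p⇒p≤q (subst (0ℚ ≤_) eq (ℚ.+-mono-≤ (p≤q⇒0≤q-p p₁≤q₁) (p≤q⇒0≤q-p p₂≤q₂)))

≤-by-double-sum : ∀ {p₁ q₁ p₂ q₂ p q : ℚ} → p₁ ≤ q₁ → p₂ ≤ q₂ →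
                  (q₁ - p₁) + (q₂ - p₂) ≡ (q - p) + (q - p) → p ≤ q
≤-by-double-sum {p = p} {q} p₁≤q₁ p₂≤q₂ eq = 0≤q-p⇒p≤q (subst (0ℚ ≤_) half
  (ℚ.*-monoˡ-≤-nonNeg ½ (subst (0ℚ ≤_) eq (ℚ.+-mono-≤ (p≤q⇒0≤q-p p₁≤q₁) (p≤q⇒0≤q-p p₂≤q₂)))))
  where
  ½ : ℚ
  ½ = + 1 / 2
  half : ½ * ((q - p) + (q - p)) ≡ q - p
  half = solve 1 (λ d → con ½ :* (d :+ d) := d) refl (q - p)

submodular⇒diminishing-returns : ∀ {f : SetFn n} {A B : Subset n} → Submodular f →
  A ⊆ B → x ∉ B → f (B ∪ ⁅ x ⁆) + f A ≤ f (A ∪ ⁅ x ⁆) + f B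
submodular⇒diminishing-returns {x = x} {f = f} {A} {B} submodular A⊆B x∉B =
  subst₂ (λ C D → f C + f D ≤ f (A ∪ ⁅ x ⁆) + f B)
    (p⊆q⇒[p∪⁅x⁆]∪q≡q∪⁅x⁆ A⊆B) (trans (x∉q⇒[p∪⁅x⁆]∩q≡p∩q x∉B) (p⊆q⇒p∩q≡p A⊆B))
    (submodular (A ∪ ⁅ x ⁆) B)

module DoubleGreedy {n : ℕ} (f : SetFn n) where

  record GreedyInvariant (X Y : Subset n) (added pending : List (Fin n)) : Set where
    field
      X⊆Y            : X ⊆ Y
      pending-unique : Unique pending
      pending⊆Y      : ∀ {x} → x ∈ₗ pending → x ∈ Y
      pending∉X      : ∀ {x} → x ∈ₗ pending → x ∉ X
      Y─X⊆pending    : ∀ {x} → x ∈ Y → x ∉ X → x ∈ₗ pending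
      X⊆added        : ∀ {x} → x ∈ X → x ∈ₗ added
      added⊆X        : ∀ {x} → x ∈ₗ added → x ∈ X

  Invariant : GState n → List (Fin n) → Set
  Invariant (X , Y , added) = GreedyInvariant X Y added

  private variable
    X Y : Subset n
    L R : List (Fin n)

  private
    ≢-head : Unique (u ∷ R) → x ∈ₗ R → x ≢ u
    ≢-head uniq x∈R refl = All.lookup (AllPairs.head uniq) x∈R refl

    ∈-tail : x ∈ₗ u ∷ R → x ≢ u → x ∈ₗ R
    ∈-tail (here x≡u) x≢u = contradiction x≡u x≢u
    ∈-tail (there x∈R) _  = x∈R

  invariant-add : GreedyInvariant X Y L (u ∷ R) → GreedyInvariant (X ∪ ⁅ u ⁆) Y (L ∷ʳ u) R
  invariant-add {X} {Y} {L} {u} {R} inv = record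
    { X⊆Y            = X′⊆Y
    ; pending-unique = AllPairs.tail pending-unique
    ; pending⊆Y      = pending⊆Y ∘ there
    ; pending∉X      = pending∉X′
    ; Y─X⊆pending    = λ x∈Y x∉X′ → ∈-tail (Y─X⊆pending x∈Y (x∉X′ ∘ x∈p∪q⁺ ∘ inj₁))
                                           (λ { refl → x∉X′ (x∈p∪q⁺ (inj₂ (x∈⁅x⁆ u))) })
    ; X⊆added        = X′⊆added
    ; added⊆X        = added⊆X′
    }
    where
    open GreedyInvariant inv
    X′⊆Y : X ∪ ⁅ u ⁆ ⊆ Y
    X′⊆Y x∈ = [ X⊆Y , x∈p⇒⁅x⁆⊆p (pending⊆Y (here refl)) ] (x∈p∪q⁻ X ⁅ u ⁆ x∈)
    pending∉X′ : x ∈ₗ R → x ∉ X ∪ ⁅ u ⁆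
    pending∉X′ x∈R x∈ =
      [ pending∉X (there x∈R) , ≢-head pending-unique x∈R ∘ x∈⁅y⁆⇒x≡y u ] (x∈p∪q⁻ X ⁅ u ⁆ x∈)
    X′⊆added : x ∈ X ∪ ⁅ u ⁆ → x ∈ₗ L ∷ʳ u
    X′⊆added x∈ with x∈p∪q⁻ X ⁅ u ⁆ x∈
    ... | inj₁ x∈X   = ∈-++⁺ˡ (X⊆added x∈X)
    ... | inj₂ x∈⁅u⁆ rewrite x∈⁅y⁆⇒x≡y u x∈⁅u⁆ = ∈-++⁺ʳ L (here refl)
    added⊆X′ : x ∈ₗ L ∷ʳ u → x ∈ X ∪ ⁅ u ⁆
    added⊆X′ x∈ with ∈-++⁻ L x∈
    ... | inj₁ x∈L         = x∈p∪q⁺ (inj₁ (added⊆X x∈L))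
    ... | inj₂ (here refl) = x∈p∪q⁺ (inj₂ (x∈⁅x⁆ u))

  invariant-remove : GreedyInvariant X Y L (u ∷ R) → GreedyInvariant X (Y ─ ⁅ u ⁆) L R
  invariant-remove {X} {Y} {L} {u} {R} inv = record
    { X⊆Y            = p⊆q∧x∉p⇒p⊆q-x X⊆Y (pending∉X (here refl))
    ; pending-unique = AllPairs.tail pending-unique
    ; pending⊆Y      = λ x∈R → x∈p∧x≢y⇒x∈p-y (pending⊆Y (there x∈R)) (≢-head pending-unique x∈R)
    ; pending∉X      = pending∉X ∘ there
    ; Y─X⊆pending    = λ x∈Y′ x∉X → ∈-tail (Y─X⊆pending (p─q⊆p Y ⁅ u ⁆ x∈Y′) x∉X)
                                           (λ { refl → x∉p-x x∈Y′ })
    ; X⊆added        = X⊆added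
    ; added⊆X        = added⊆X
    }
    where open GreedyInvariant inv

  invariant-step : ∀ s → Invariant s (u ∷ R) → Invariant (greedyStep f s u) R
  invariant-step {u = u} (X , Y , L) inv with f (Y ─ ⁅ u ⁆) - f Y ≤ᵇ f (X ∪ ⁅ u ⁆) - f X
  ... | true  = invariant-add inv
  ... | false = invariant-remove inv

  greedyRun-invariant : ∀ s R → Invariant s R → Invariant (greedyRun f s R) []
  greedyRun-invariant s []      inv = inv
  greedyRun-invariant s (u ∷ R) inv = greedyRun-invariant (greedyStep f s u) R (invariant-step s inv)

  module _ (Xs : Subset n) where

    potential : GState n → ℚ
    potential (X , Y , _) = f ((Xs ∪ X) ∩ Y) + f X + f Y

    module _ (submodular : Submodular f) where

      module _ {X Y : Subset n} {u : Fin n} (L : List (Fin n))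
               (X⊆Y : X ⊆ Y) (u∈Y : u ∈ Y) (u∉X : u ∉ X) where
        private
          Y′ = Y ─ ⁅ u ⁆
          X′ = X ∪ ⁅ u ⁆
          O  = (Xs ∪ X) ∩ Y

          diminishing : ∀ {A B} → A ⊆ B → u ∉ B → f (B ∪ ⁅ u ⁆) + f A ≤ f (A ∪ ⁅ u ⁆) + f B
          diminishing = submodular⇒diminishing-returns {f = f} submodular

          diminishing-Y′ : ∀ {A} → A ⊆ Y′ → f Y + f A ≤ f (A ∪ ⁅ u ⁆) + f Y′
          diminishing-Y′ {A} A⊆Y′ =
            subst (λ C → f C + f A ≤ f (A ∪ ⁅ u ⁆) + f Y′) (x∈p⇒p-x∪⁅x⁆≡p u∈Y) (diminishing A⊆Y′ x∉p-x)

          X⊆Y′ : X ⊆ Y′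
          X⊆Y′ = p⊆q∧x∉p⇒p⊆q-x X⊆Y u∉X

          gains-nonneg : f Y + f X ≤ f X′ + f Y′
          gains-nonneg = diminishing-Y′ X⊆Y′

          u∉O : u ∉ Xs → u ∉ O
          u∉O u∉Xs u∈O = [ u∉Xs , u∉X ] (x∈p∪q⁻ Xs X (proj₁ (x∈p∩q⁻ (Xs ∪ X) Y u∈O)))

        potential-add : f Y′ - f Y ≤ f X′ - f X → potential (X , Y , L) ≤ potential (X′ , Y , L ∷ʳ u)
        potential-add b≤a with u ∈? Xs
        ... | yes u∈Xs = subst (λ C → potential (X , Y , L) ≤ f C + f X′ + f Y) (sym O′≡O)
              (≤-by-double-sum gains-nonneg b≤a
                (solve 5 (λ o x x′ y y′ → ((x′ :+ y′) :- (y :+ x)) :+ ((x′ :- x) :- (y′ :- y))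
                                         := ((o :+ x′ :+ y) :- (o :+ x :+ y)) :+ ((o :+ x′ :+ y) :- (o :+ x :+ y)))
                       refl (f O) (f X) (f X′) (f Y) (f Y′)))
          where
          O′≡O : (Xs ∪ X′) ∩ Y ≡ O
          O′≡O = cong (_∩ Y) (trans (sym (∪-assoc Xs X ⁅ u ⁆)) (x∈p⇒p∪⁅x⁆≡p (x∈p∪q⁺ (inj₁ u∈Xs))))
        ... | no u∉Xs = subst (λ C → potential (X , Y , L) ≤ f C + f X′ + f Y) (sym O′≡O∪u)
              (≤-by-sum (diminishing-Y′ (p⊆q∧x∉p⇒p⊆q-x (p∩q⊆q (Xs ∪ X) Y) (u∉O u∉Xs))) b≤a
                (solve 6 (λ o o′ x x′ y y′ → ((o′ :+ y′) :- (y :+ o)) :+ ((x′ :- x) :- (y′ :- y))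
                                            := (o′ :+ x′ :+ y) :- (o :+ x :+ y))
                       refl (f O) (f (O ∪ ⁅ u ⁆)) (f X) (f X′) (f Y) (f Y′)))
          where
          O′≡O∪u : (Xs ∪ X′) ∩ Y ≡ O ∪ ⁅ u ⁆
          O′≡O∪u = trans (cong (_∩ Y) (sym (∪-assoc Xs X ⁅ u ⁆))) (x∈q⇒[p∪⁅x⁆]∩q≡p∩q∪⁅x⁆ u∈Y)

        potential-remove : f X′ - f X ≤ f Y′ - f Y → potential (X , Y , L) ≤ potential (X , Y′ , L)
        potential-remove a≤b with u ∈? Xs
        ... | yes u∈Xs = ≤-by-sum gain-O″ a≤b
                (solve 6 (λ o o″ x x′ y y′ → ((x′ :+ o″) :- (o :+ x)) :+ ((y′ :- y) :- (x′ :- x))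
                                            := (o″ :+ x :+ y′) :- (o :+ x :+ y))
                       refl (f O) (f O″) (f X) (f X′) (f Y) (f Y′))
          where
          O″ = (Xs ∪ X) ∩ Y′
          O″∪u≡O : O″ ∪ ⁅ u ⁆ ≡ O
          O″∪u≡O = trans (cong (_∪ ⁅ u ⁆) p∩[q─r]≡p∩q─r)
                         (x∈p⇒p-x∪⁅x⁆≡p (x∈p∩q⁺ (x∈p∪q⁺ (inj₁ u∈Xs) , u∈Y)))
          X⊆O″ : X ⊆ O″
          X⊆O″ x∈X = x∈p∩q⁺ (q⊆p∪q Xs X x∈X , X⊆Y′ x∈X)
          gain-O″ : f O + f X ≤ f X′ + f O″
          gain-O″ = subst (λ C → f C + f X ≤ f X′ + f O″) O″∪u≡O
                      (diminishing X⊆O″ (x∉p-x ∘ proj₂ ∘ x∈p∩q⁻ (Xs ∪ X) Y′))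
        ... | no u∉Xs = subst (λ C → potential (X , Y , L) ≤ f C + f X + f Y′) (sym O″≡O)
              (≤-by-double-sum gains-nonneg a≤b
                (solve 5 (λ o x x′ y y′ → ((x′ :+ y′) :- (y :+ x)) :+ ((y′ :- y) :- (x′ :- x))
                                         := ((o :+ x :+ y′) :- (o :+ x :+ y)) :+ ((o :+ x :+ y′) :- (o :+ x :+ y)))
                       refl (f O) (f X) (f X′) (f Y) (f Y′)))
          where
          O″≡O : (Xs ∪ X) ∩ Y′ ≡ O
          O″≡O = trans p∩[q─r]≡p∩q─r (x∉p⇒p-x≡p (u∉O u∉Xs))

      potential-step : ∀ s → Invariant s (u ∷ R) → potential s ≤ potential (greedyStep f s u)
      potential-step {u = u} (X , Y , L) inv with f (Y ─ ⁅ u ⁆) - f Y ≤ᵇ f (X ∪ ⁅ u ⁆) - f X in b≤ᵇa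
      ... | true  = potential-add L X⊆Y (pending⊆Y (here refl)) (pending∉X (here refl))
                      (ℚ.≤ᵇ⇒≤ (subst T (sym b≤ᵇa) _))
        where open GreedyInvariant inv
      ... | false = potential-remove L X⊆Y (pending⊆Y (here refl)) (pending∉X (here refl))
                      (ℚ.<⇒≤ (ℚ.≰⇒> (λ b≤a → subst T b≤ᵇa (ℚ.≤⇒≤ᵇ b≤a))))
        where open GreedyInvariant inv

      greedyRun-potential : ∀ s R → Invariant s R → potential s ≤ potential (greedyRun f s R)
      greedyRun-potential s []      _   = ℚ.≤-refl
      greedyRun-potential s (u ∷ R) inv =
        ℚ.≤-trans (potential-step s inv) (greedyRun-potential (greedyStep f s u) R (invariant-step s inv))

module _ (f : SetFn n) (τ : Permutation′ n) where
  open DoubleGreedy f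

  private
    initial-invariant : GreedyInvariant ⊥ ⊤ [] (map (τ ⟨$⟩ʳ_) (allFin n))
    initial-invariant = record
      { X⊆Y            = ⊥⊆
      ; pending-unique = Unique.map⁺ (λ eq → trans (sym (inverseˡ τ)) (trans (cong (τ ⟨$⟩ˡ_) eq) (inverseˡ τ)))
                                     (Unique.allFin⁺ n)
      ; pending⊆Y      = λ _ → ∈⊤
      ; pending∉X      = λ _ → ∉⊥
      ; Y─X⊆pending    = λ {x} _ _ → subst (_∈ₗ _) (inverseʳ τ) (∈-map⁺ (τ ⟨$⟩ʳ_) (∈-allFin (τ ⟨$⟩ˡ x)))
      ; X⊆added        = λ x∈⊥ → contradiction x∈⊥ ∉⊥
      ; added⊆X        = λ ()
      }

    open GreedyInvariant (greedyRun-invariant (⊥ , ⊤ , []) (map (τ ⟨$⟩ʳ_) (allFin n)) initial-invariant)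

    S = greedyOut f τ

    Y≡S : proj₁ (proj₂ (greedy f τ)) ≡ S
    Y≡S = ⊆-antisym (λ {x} x∈Y → decide x∈Y (x ∈? S)) X⊆Y
      where
      decide : x ∈ proj₁ (proj₂ (greedy f τ)) → Dec (x ∈ S) → x ∈ S
      decide _   (yes x∈S) = x∈S
      decide x∈Y (no x∉S)  with () ← Y─X⊆pending x∈Y x∉S

  ∈greedyOut⇒∈greedyAdded : x ∈ greedyOut f τ → x ∈ₗ greedyAdded f τ
  ∈greedyOut⇒∈greedyAdded = X⊆added

  ∈greedyAdded⇒∈greedyOut : x ∈ₗ greedyAdded f τ → x ∈ greedyOut f τ
  ∈greedyAdded⇒∈greedyOut = added⊆X

  greedy-⅓-approximation : Nonneg f → Submodular f → ∀ Xs → ((+ 1) / 3) * f Xs ≤ f (greedyOut f τ)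
  greedy-⅓-approximation nonneg submodular Xs = begin
    ⅓ * f Xs              ≤⟨ ℚ.*-monoˡ-≤-nonNeg ⅓ (subst (f Xs ≤_) final (ℚ.≤-trans initial potential-grows)) ⟩
    ⅓ * (f S + f S + f S) ≡⟨ solve 1 (λ s → con ⅓ :* (s :+ s :+ s) := s) refl (f S) ⟩
    f S                   ∎
    where
    open ℚ.≤-Reasoning
    ⅓ : ℚ
    ⅓ = + 1 / 3
    initial : f Xs ≤ potential Xs (⊥ , ⊤ , [])
    initial = subst (λ C → f Xs ≤ f C + f ⊥ + f ⊤) (sym (trans (∩-identityʳ (Xs ∪ ⊥)) (∪-identityʳ Xs)))
      (≤-by-sum (nonneg ⊥) (nonneg ⊤)
        (solve 3 (λ a b c → (b :- con 0ℚ) :+ (c :- con 0ℚ) := (a :+ b :+ c) :- a) refl (f Xs) (f ⊥) (f ⊤)))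
    potential-grows : potential Xs (⊥ , ⊤ , []) ≤ potential Xs (greedy f τ)
    potential-grows = greedyRun-potential Xs submodular (⊥ , ⊤ , []) _ initial-invariant
    final : potential Xs (greedy f τ) ≡ f S + f S + f S
    final rewrite Y≡S = cong (λ C → f C + f S + f S) (trans (∩-comm (Xs ∪ S) S) (p⊆q⇒p∩q≡p (q⊆p∪q Xs S)))

-- hSet f σ unfolds to modular (hElem f σ).
modular : (Fin n → ℚ) → Subset n → ℚ
modular {n} w X = foldr _+_ 0ℚ (map (λ x → if lookup X x then w x else 0ℚ) (allFin n))

modular-∷ : ∀ (w : Fin (suc n) → ℚ) a A →
            modular w (a ∷ A) ≡ (if a then w zero else 0ℚ) + modular (w ∘ suc) A
modular-∷ w a A = cong (λ m → (if a then w zero else 0ℚ) + m) (cong (foldr _+_ 0ℚ)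
  (trans (map-tabulate suc (λ x → if lookup (a ∷ A) x then w x else 0ℚ))
         (sym (map-tabulate id (λ x → if lookup A x then w (suc x) else 0ℚ)))))

modular-⊥ : ∀ (w : Fin n → ℚ) → modular w ⊥ ≡ 0ℚ
modular-⊥ {zero}  w = refl
modular-⊥ {suc n} w =
  trans (modular-∷ w false ⊥) (trans (cong (λ m → 0ℚ + m) (modular-⊥ (w ∘ suc))) (ℚ.+-identityˡ 0ℚ))

modular-insert : ∀ (w : Fin n → ℚ) {A : Subset n} {x : Fin n} → x ∉ A → modular w (A ∪ ⁅ x ⁆) ≡ modular w A + w x
modular-insert w {true ∷ A}  {zero}  x∉A = contradiction here x∉A
modular-insert w {false ∷ A} {zero}  _   = begin
  modular w (true ∷ (A ∪ ⊥))          ≡⟨ modular-∷ w true (A ∪ ⊥) ⟩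
  w zero + modular (w ∘ suc) (A ∪ ⊥)  ≡⟨ cong (λ m → w zero + modular (w ∘ suc) m) (∪-identityʳ A) ⟩
  w zero + modular (w ∘ suc) A        ≡⟨ solve 2 (λ a m → a :+ m := (con 0ℚ :+ m) :+ a) refl
                                                 (w zero) (modular (w ∘ suc) A) ⟩
  (0ℚ + modular (w ∘ suc) A) + w zero ≡⟨ cong (_+ w zero) (modular-∷ w false A) ⟨
  modular w (false ∷ A) + w zero      ∎
  where open ≡-Reasoning
modular-insert w {a ∷ A}     {suc x} x∉A = begin
  modular w ((a ∷ A) ∪ ⁅ suc x ⁆)                  ≡⟨ modular-∷ w (a ∨ false) (A ∪ ⁅ x ⁆) ⟩
  head (a ∨ false) + modular (w ∘ suc) (A ∪ ⁅ x ⁆)  ≡⟨ cong₂ _+_ (cong head (∨-identityʳ a))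
                                                              (modular-insert (w ∘ suc) (x∉A ∘ there)) ⟩
  head a + (modular (w ∘ suc) A + w (suc x))       ≡⟨ ℚ.+-assoc (head a) _ _ ⟨
  (head a + modular (w ∘ suc) A) + w (suc x)       ≡⟨ cong (_+ w (suc x)) (modular-∷ w a A) ⟨
  modular w (a ∷ A) + w (suc x)                    ∎
  where
  open ≡-Reasoning
  head : Bool → ℚ
  head b = if b then w zero else 0ℚ

module Prefix (σ : Permutation′ n) where

  position : Fin n → ℕ
  position x = toℕ (σ ⟨$⟩ˡ x)

  position-injective : ∀ {x y} → position x ≡ position y → x ≡ y
  position-injective {x} {y} eq = begin
    x                   ≡⟨ inverseʳ σ ⟨
    σ ⟨$⟩ʳ (σ ⟨$⟩ˡ x)  ≡⟨ cong (σ ⟨$⟩ʳ_) (toℕ-injective eq) ⟩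
    σ ⟨$⟩ʳ (σ ⟨$⟩ˡ y)  ≡⟨ inverseʳ σ ⟩
    y                   ∎
    where open ≡-Reasoning

  ∈-prefix⁺ : ∀ {x k} → position x < k → x ∈ prefix σ k
  ∈-prefix⁺ {x} {k} lt = lookup⇒[]= x (prefix σ k)
    (trans (lookup∘tabulate (λ y → position y <ᵇ k) x) (Equivalence.to T-≡ (<⇒<ᵇ lt)))

  ∈-prefix⁻ : ∀ {x k} → x ∈ prefix σ k → position x < k
  ∈-prefix⁻ {x} {k} x∈ = <ᵇ⇒< (position x) k
    (Equivalence.from T-≡ (trans (sym (lookup∘tabulate (λ y → position y <ᵇ k) x)) ([]=⇒lookup x∈)))

  prefix-zero : prefix σ 0 ≡ ⊥
  prefix-zero = Empty-unique (λ (_ , x∈) → n≮0 (∈-prefix⁻ x∈))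

  prefix-full : prefix σ n ≡ ⊤
  prefix-full = ⊆-antisym ⊆⊤ (λ {x} _ → ∈-prefix⁺ (toℕ<n (σ ⟨$⟩ˡ x)))

  module _ {k : ℕ} (k<n : k < n) where

    next : Fin n
    next = σ ⟨$⟩ʳ fromℕ< k<n

    position-next : position next ≡ k
    position-next = trans (cong toℕ (inverseˡ σ)) (toℕ-fromℕ< k<n)

    next∉prefix : next ∉ prefix σ k
    next∉prefix next∈ = n≮n k (subst (_< k) position-next (∈-prefix⁻ next∈))

    prefix-suc : prefix σ (suc k) ≡ prefix σ k ∪ ⁅ next ⁆
    prefix-suc = ⊆-antisym forward backward
      where
      forward : prefix σ (suc k) ⊆ prefix σ k ∪ ⁅ next ⁆
      forward x∈ with m<1+n⇒m<n∨m≡n (∈-prefix⁻ x∈)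
      ... | inj₁ lt = x∈p∪q⁺ (inj₁ (∈-prefix⁺ lt))
      ... | inj₂ eq rewrite position-injective (trans eq (sym position-next)) = x∈p∪q⁺ (inj₂ (x∈⁅x⁆ next))
      backward : prefix σ k ∪ ⁅ next ⁆ ⊆ prefix σ (suc k)
      backward x∈ with x∈p∪q⁻ (prefix σ k) ⁅ next ⁆ x∈
      ... | inj₁ x∈P      = ∈-prefix⁺ (m<n⇒m<1+n (∈-prefix⁻ x∈P))
      ... | inj₂ x∈⁅next⁆ rewrite x∈⁅y⁆⇒x≡y next x∈⁅next⁆ =
        ∈-prefix⁺ (subst (_< suc k) (sym position-next) (n<1+n k))

module _ (f : SetFn n) (σ : Permutation′ n) where
  open Prefix σ

  hElem-next : ∀ {k} (k<n : k < n) → hElem f σ (next k<n) ≡ f (prefix σ k ∪ ⁅ next k<n ⁆) - f (prefix σ k)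
  hElem-next {k} k<n = trans (cong (λ i → f (prefix σ (suc i)) - f (prefix σ i)) (position-next k<n))
                             (cong (λ P → f P - f (prefix σ k)) (prefix-suc k<n))

  hSet-⊥ : hSet f σ ⊥ + f ⊥ ≡ f ⊥
  hSet-⊥ = trans (cong (_+ f ⊥) (modular-⊥ (hElem f σ))) (ℚ.+-identityˡ (f ⊥))

  hSet-prefix : ∀ k → k ℕ.≤ n → hSet f σ (prefix σ k) + f ⊥ ≡ f (prefix σ k)
  hSet-prefix zero    _   rewrite prefix-zero = hSet-⊥
  hSet-prefix (suc k) k<n = begin
    hSet f σ (prefix σ (suc k)) + f ⊥  ≡⟨ cong (λ C → hSet f σ C + f ⊥) (prefix-suc k<n) ⟩
    hSet f σ (P ∪ ⁅ y ⁆) + f ⊥         ≡⟨ cong (_+ f ⊥) (modular-insert (hElem f σ) (next∉prefix k<n)) ⟩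
    (hSet f σ P + hElem f σ y) + f ⊥   ≡⟨ solve 3 (λ h e z → (h :+ e) :+ z := (h :+ z) :+ e) refl
                                                 (hSet f σ P) (hElem f σ y) (f ⊥) ⟩
    (hSet f σ P + f ⊥) + hElem f σ y   ≡⟨ cong₂ _+_ (hSet-prefix k (<⇒≤ k<n)) (hElem-next k<n) ⟩
    f P + (f (P ∪ ⁅ y ⁆) - f P)        ≡⟨ solve 2 (λ p p′ → p :+ (p′ :- p) := p′) refl (f P) (f (P ∪ ⁅ y ⁆)) ⟩
    f (P ∪ ⁅ y ⁆)                      ≡⟨ cong f (prefix-suc k<n) ⟨
    f (prefix σ (suc k))               ∎
    where
    open ≡-Reasoning
    P = prefix σ k
    y = next k<n

  module _ (submodular : Submodular f) where

    hSet-prefix∩ : ∀ X k → k ℕ.≤ n → hSet f σ (prefix σ k ∩ X) + f ⊥ ≤ f (prefix σ k ∩ X)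
    hSet-prefix∩ X zero    _   rewrite prefix-zero | ∩-zeroˡ X = ℚ.≤-reflexive hSet-⊥
    hSet-prefix∩ X (suc k) k<n with next k<n ∈? X
    ... | yes y∈X = subst (λ C → hSet f σ C + f ⊥ ≤ f C)
                      (sym (trans (cong (_∩ X) (prefix-suc k<n)) (x∈q⇒[p∪⁅x⁆]∩q≡p∩q∪⁅x⁆ y∈X))) insert-y
      where
      P = prefix σ k
      y = next k<n
      A = P ∩ X
      hSet-A∪y : hSet f σ (A ∪ ⁅ y ⁆) ≡ hSet f σ A + (f (P ∪ ⁅ y ⁆) - f P)
      hSet-A∪y = trans (modular-insert (hElem f σ) (next∉prefix k<n ∘ proj₁ ∘ x∈p∩q⁻ P X))
                       (cong (λ e → hSet f σ A + e) (hElem-next k<n))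
      insert-y : hSet f σ (A ∪ ⁅ y ⁆) + f ⊥ ≤ f (A ∪ ⁅ y ⁆)
      insert-y = subst (λ h → h + f ⊥ ≤ f (A ∪ ⁅ y ⁆)) (sym hSet-A∪y)
        (≤-by-sum (hSet-prefix∩ X k (<⇒≤ k<n))
                  (submodular⇒diminishing-returns {f = f} submodular (p∩q⊆p P X) (next∉prefix k<n))
                  (solve 6 (λ h z a a′ p p′ → (a :- (h :+ z)) :+ ((a′ :+ p) :- (p′ :+ a))
                                             := a′ :- ((h :+ (p′ :- p)) :+ z))
                         refl (hSet f σ A) (f ⊥) (f A) (f (A ∪ ⁅ y ⁆)) (f P) (f (P ∪ ⁅ y ⁆))))
    ... | no y∉X = subst (λ C → hSet f σ C + f ⊥ ≤ f C)
                     (sym (trans (cong (_∩ X) (prefix-suc k<n)) (x∉q⇒[p∪⁅x⁆]∩q≡p∩q y∉X)))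
                     (hSet-prefix∩ X k (<⇒≤ k<n))

    hSet≤f : ∀ X → hSet f σ X + f ⊥ ≤ f X
    hSet≤f X = subst (λ C → hSet f σ C + f ⊥ ≤ f C) (trans (cong (_∩ X) prefix-full) (∩-identityˡ X))
                 (hSet-prefix∩ X n ≤-refl)

∈-take-tabulate⁻ : ∀ {A : Set} {m} (g : Fin m → A) k {z} → z ∈ₗ take k (tabulate g) →
                   ∃ λ i → toℕ i < k × z ≡ g i
∈-take-tabulate⁻ {m = suc m} g (suc k) (here z≡g0) = zero , z<s , z≡g0
∈-take-tabulate⁻ {m = suc m} g (suc k) (there z∈) =
  let i , i<k , z≡gi = ∈-take-tabulate⁻ (g ∘ suc) k z∈ in suc i , s<s i<k , z≡gi

∈-take-tabulate⁺ : ∀ {A : Set} {m} (g : Fin m → A) {k} i → toℕ i < k → g i ∈ₗ take k (tabulate g)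
∈-take-tabulate⁺ g zero    z<s       = here refl
∈-take-tabulate⁺ g (suc i) (s<s i<k) = there (∈-take-tabulate⁺ (g ∘ suc) i i<k)

module _ (f : SetFn n) (τ σ : Permutation′ n) {k : ℕ}
         (σ-prefix : take k (map (σ ⟨$⟩ʳ_) (allFin n)) ≡ greedyAdded f τ) where
  open Prefix σ

  private
    σ-list : map (σ ⟨$⟩ʳ_) (allFin n) ≡ tabulate (σ ⟨$⟩ʳ_)
    σ-list = map-tabulate id (σ ⟨$⟩ʳ_)

  greedyOut≡prefix : greedyOut f τ ≡ prefix σ k
  greedyOut≡prefix = ⊆-antisym out⊆prefix prefix⊆out
    where
    out⊆prefix : greedyOut f τ ⊆ prefix σ k
    out⊆prefix {x} x∈ with ∈-take-tabulate⁻ (σ ⟨$⟩ʳ_) k (subst (x ∈ₗ_) (trans (sym σ-prefix) (cong (take k) σ-list))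
                                                            (∈greedyOut⇒∈greedyAdded f τ x∈))
    ... | i , i<k , refl = ∈-prefix⁺ (subst (_< k) (sym (cong toℕ (inverseˡ σ))) i<k)
    prefix⊆out : prefix σ k ⊆ greedyOut f τ
    prefix⊆out {x} x∈ = ∈greedyAdded⇒∈greedyOut f τ
      (subst₂ _∈ₗ_ (inverseʳ σ) (trans (cong (take k) (sym σ-list)) σ-prefix)
        (∈-take-tabulate⁺ (σ ⟨$⟩ʳ_) (σ ⟨$⟩ˡ x) (∈-prefix⁻ x∈)))

  greedyAdded-length≤n : length (greedyAdded f τ) ℕ.≤ n
  greedyAdded-length≤n = begin
    length (greedyAdded f τ)                   ≡⟨ cong length σ-prefix ⟨
    length (take k (map (σ ⟨$⟩ʳ_) (allFin n))) ≡⟨ length-take k (map (σ ⟨$⟩ʳ_) (allFin n)) ⟩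
    k ⊓ length (map (σ ⟨$⟩ʳ_) (allFin n))      ≤⟨ m⊓n≤n k _ ⟩
    length (map (σ ⟨$⟩ʳ_) (allFin n))          ≡⟨ trans (length-map (σ ⟨$⟩ʳ_) (allFin n)) (length-tabulate id) ⟩
    n                                          ∎
    where open ≤-Reasoning

lemma15 : (n : ℕ) (f : SetFn n) → Nonneg f → Submodular f → Normalized f →
          (Xstar : Subset n) → IsMaximizer f Xstar →
          (τ : Permutation′ n) →
          (σ : Permutation′ n) →
          take (length (greedyAdded f τ)) (map (σ ⟨$⟩ʳ_) (allFin n)) ≡ greedyAdded f τ →
          (X1 : Subset n) → IsMaximizer (hSet f σ) X1 →
          ((+ 1) / 3) * f Xstar ≤ f X1
lemma15 n f nonneg submodular _ Xstar _ τ σ σ-prefix X1 X1-maximizes = begin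
  ((+ 1) / 3) * f Xstar   ≤⟨ greedy-⅓-approximation f τ nonneg submodular Xstar ⟩
  f (greedyOut f τ)       ≡⟨ cong f (greedyOut≡prefix f τ σ σ-prefix) ⟩
  f P                     ≡⟨ hSet-prefix f σ _ (greedyAdded-length≤n f τ σ σ-prefix) ⟨
  hSet f σ P + f ⊥        ≤⟨ ℚ.+-monoˡ-≤ (f ⊥) (X1-maximizes P) ⟩
  hSet f σ X1 + f ⊥       ≤⟨ hSet≤f f σ submodular X1 ⟩
  f X1                    ∎
  where
  open ℚ.≤-Reasoning
  P = prefix σ (length (greedyAdded f τ))
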